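{- For all positive integers $n,s$, $$\sum_{k=0}^{n-1}\frac{(-1)^k}{(2k+1)^s}=\sum_{k=1}^n(-1)^{k-1}\binom{n}{k}\,{}_{s+1}F_s\left(\tfrac12,\ldots,\tfrac12,1-k;\tfrac32,\ldots,\tfrac32;-1\right),$$ where $\tfrac12$ and $\tfrac32$ each appear $s$ times.
   Context: ${}_{s+1}F_s(a_1,\ldots,a_{s+1};b_1,\ldots,b_s;x)=\sum_{i\ge0}\frac{(a_1)_i\cdots(a_{s+1})_i}{(b_1)_i\cdots(b_s)_i}\frac{x^i}{i!}$, with $(a)_0=1$, $(a)_i=a(a+1)\cdots(a+i-1)$; with an upper parameter $1-k$ ($k$ a positive integer) the series terminates. -}

module Defs where

open import Data.Nat as ℕ using (ℕ; zero; suc)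
open import Data.Nat.Combinatorics using (_C_)
open import Data.Integer as ℤ using (+_)
open import Data.Rational as ℚ using (ℚ; 0ℚ; 1ℚ; _+_; _*_; _-_; _÷_; -_; _/_)
open import Data.Rational.Properties using (_≟_)
open import Data.List using (List; []; _∷_; foldr; replicate; map)
open import Relation.Nullary using (yes; no)

ℕ→ℚ : ℕ → ℚ
ℕ→ℚ n = (+ n) / 1

Σ< : ℕ → (ℕ → ℚ) → ℚ
Σ< zero    f = 0ℚ
Σ< (suc n) f = Σ< n f + f n

sgn : ℕ → ℚ
sgn zero    = 1ℚ
sgn (suc k) = - sgn k

pow : ℚ → ℕ → ℚ
pow q zero    = 1ℚ
pow q (suc n) = pow q n * q

poch : ℚ → ℕ → ℚ
poch a zero    = 1ℚ
poch a (suc i) = poch a i * (a + ℕ→ℚ i)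

-- total division (only used where the divisor is nonzero)
_÷'_ : ℚ → ℚ → ℚ
p ÷' q with q ≟ 0ℚ
... | yes _ = 0ℚ
... | no ¬z = _÷_ p q {{ℚ.≢-nonZero ¬z}}

prodL : List ℚ → ℚ
prodL = foldr _*_ 1ℚ

hypTerm : List ℚ → List ℚ → ℚ → ℕ → ℚ
hypTerm as bs x i =
  (prodL (map (λ a → poch a i) as)
     ÷' (prodL (map (λ b → poch b i) bs) * ℕ→ℚ (i ℕ.!)))
  * pow x i

-- Partial sum  Σ_{i < N} of the hypergeometric series.  When some upper parameter
-- is 1-k (k ≥ 1) all terms with i ≥ k vanish, so for N ≥ k this is the value of the
-- (terminating) series.
hypPartial : ℕ → List ℚ → List ℚ → ℚ → ℚ
hypPartial N as bs x = Σ< N (hypTerm as bs x)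

half threeHalves : ℚ
half = (+ 1) / 2
threeHalves = (+ 3) / 2

oneMinus : ℕ → ℚ
oneMinus k = 1ℚ - ℕ→ℚ k

-- Put a_i = 1/(2i+1)^s.  Since (1/2)_i/(3/2)_i = 1/(2i+1) and the upper parameter
-- 1-(j+1) = -j gives (-j)_i (-1)^i / i! = C(j,i), the j-th hypergeometric sum on the right
-- is the binomial transform b_j = Σ_{i≤j} C(j,i) a_i.  What remains is the identity
-- Σ_{j<n} (-1)^j C(n,j+1) b_j = Σ_{k<n} (-1)^k a_k for an arbitrary sequence a, proved by
-- induction on n with Pascal's rule used twice: for C(n+1,j+1), and in the form
-- b_{j+1} = b_j + b'_j, where b' is the binomial transform of the shifted sequence a_{i+1}.
module Submission where

open import Defs
open import Data.Nat using (ℕ; suc)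
open import Data.Nat.Combinatorics using (_C_)
open import Data.Rational using (ℚ; 1ℚ; _*_; -_)
import Data.Nat
open import Data.List using (replicate; _∷ʳ_)
open import Relation.Binary.PropositionalEquality using (_≡_)

open import Data.Nat as ℕ using (zero; _!)
open import Data.Nat.Combinatorics using (nCk+nC[k+1]≡[n+1]C[k+1]; k>n⇒nCk≡0)
import Data.Nat.Properties as ℕ
import Data.Integer as ℤ
import Data.Integer.Properties as ℤ
import Data.Integer.Solver as ℤ-Solver
open import Data.Rational using (0ℚ; _+_; _-_; Positive; toℚᵘ; 1/_)
open import Data.Rational.Properties
import Data.Rational.Unnormalised as ℚᵘ
import Data.Rational.Unnormalised.Properties as ℚᵘ
open import Data.Rational.Solver using (module +-*-Solver)
open import Data.List using ([]; _∷_; map)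
open import Data.List.Properties using (map-++; map-replicate)
open import Function using (_∘_)
open import Relation.Binary.PropositionalEquality using (refl; sym; trans; cong; cong₂; module ≡-Reasoning)
open import Relation.Nullary using (yes; no; contradiction)

fromℕᵘ : ℕ → ℚᵘ.ℚᵘ
fromℕᵘ n = ℚᵘ.mkℚᵘ (ℤ.+ n) 0

ℕ→ℚ-+ : ∀ m n → ℕ→ℚ (m ℕ.+ n) ≡ ℕ→ℚ m + ℕ→ℚ n
ℕ→ℚ-+ m n = toℚᵘ-injective (begin
  toℚᵘ (ℕ→ℚ (m ℕ.+ n))            ≈⟨ toℚᵘ-fromℚᵘ (fromℕᵘ (m ℕ.+ n)) ⟩
  fromℕᵘ (m ℕ.+ n)                 ≈⟨ ℚᵘ.*≡* (solve 2 (λ x y → (x :+ y) :* (con (ℤ.+ 1) :* con (ℤ.+ 1))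
                                         := (x :* con (ℤ.+ 1) :+ y :* con (ℤ.+ 1)) :* con (ℤ.+ 1)) refl (ℤ.+ m) (ℤ.+ n)) ⟩
  fromℕᵘ m ℚᵘ.+ fromℕᵘ n            ≈⟨ ℚᵘ.+-cong (toℚᵘ-fromℚᵘ (fromℕᵘ m)) (toℚᵘ-fromℚᵘ (fromℕᵘ n)) ⟨
  toℚᵘ (ℕ→ℚ m) ℚᵘ.+ toℚᵘ (ℕ→ℚ n)    ≈⟨ toℚᵘ-homo-+ (ℕ→ℚ m) (ℕ→ℚ n) ⟨
  toℚᵘ (ℕ→ℚ m + ℕ→ℚ n)             ∎)
  where open ℚᵘ.≃-Reasoning
        open ℤ-Solver.+-*-Solver

ℕ→ℚ-* : ∀ m n → ℕ→ℚ (m ℕ.* n) ≡ ℕ→ℚ m * ℕ→ℚ n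
ℕ→ℚ-* m n = toℚᵘ-injective (begin
  toℚᵘ (ℕ→ℚ (m ℕ.* n))            ≈⟨ toℚᵘ-fromℚᵘ (fromℕᵘ (m ℕ.* n)) ⟩
  fromℕᵘ (m ℕ.* n)                 ≈⟨ ℚᵘ.*≡* (trans (cong (ℤ._* ℤ.+ 1) (ℤ.pos-* m n))
                                         (solve 2 (λ x y → (x :* y) :* con (ℤ.+ 1)
                                           := (x :* y) :* (con (ℤ.+ 1) :* con (ℤ.+ 1))) refl (ℤ.+ m) (ℤ.+ n))) ⟩
  fromℕᵘ m ℚᵘ.* fromℕᵘ n            ≈⟨ ℚᵘ.*-cong (toℚᵘ-fromℚᵘ (fromℕᵘ m)) (toℚᵘ-fromℚᵘ (fromℕᵘ n)) ⟨
  toℚᵘ (ℕ→ℚ m) ℚᵘ.* toℚᵘ (ℕ→ℚ n)    ≈⟨ toℚᵘ-homo-* (ℕ→ℚ m) (ℕ→ℚ n) ⟨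
  toℚᵘ (ℕ→ℚ m * ℕ→ℚ n)             ∎)
  where open ℚᵘ.≃-Reasoning
        open ℤ-Solver.+-*-Solver

ℕ→ℚ-suc : ∀ n → ℕ→ℚ (suc n) ≡ 1ℚ + ℕ→ℚ n
ℕ→ℚ-suc = ℕ→ℚ-+ 1

ℕ→ℚ-pos : ∀ n .{{_ : ℕ.NonZero n}} → Positive (ℕ→ℚ n)
ℕ→ℚ-pos n = normalize-pos n 1

open +-*-Solver
open ≡-Reasoning

Σ<-cong : ∀ n {f g : ℕ → ℚ} → (∀ i → f i ≡ g i) → Σ< n f ≡ Σ< n g
Σ<-cong zero    f≗g = refl
Σ<-cong (suc n) f≗g = cong₂ _+_ (Σ<-cong n f≗g) (f≗g n)

Σ<-distrib-+ : ∀ n (f g : ℕ → ℚ) → Σ< n (λ i → f i + g i) ≡ Σ< n f + Σ< n g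
Σ<-distrib-+ zero    f g = refl
Σ<-distrib-+ (suc n) f g = begin
  Σ< n (λ i → f i + g i) + (f n + g n)  ≡⟨ cong (_+ (f n + g n)) (Σ<-distrib-+ n f g) ⟩
  Σ< n f + Σ< n g + (f n + g n)         ≡⟨ solve 4 (λ F G x y → F :+ G :+ (x :+ y) := F :+ x :+ (G :+ y))
                                             refl (Σ< n f) (Σ< n g) (f n) (g n) ⟩
  Σ< n f + f n + (Σ< n g + g n)         ∎

Σ<-neg : ∀ n (f : ℕ → ℚ) → Σ< n (λ i → - f i) ≡ - Σ< n f
Σ<-neg zero    f = refl
Σ<-neg (suc n) f = trans (cong (_+ - f n) (Σ<-neg n f)) (sym (neg-distrib-+ (Σ< n f) (f n)))

Σ<-suc : ∀ n (f : ℕ → ℚ) → Σ< (suc n) f ≡ f 0 + Σ< n (f ∘ suc)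
Σ<-suc zero    f = trans (+-identityˡ (f 0)) (sym (+-identityʳ (f 0)))
Σ<-suc (suc n) f = begin
  Σ< (suc n) f + f (suc n)                 ≡⟨ cong (_+ f (suc n)) (Σ<-suc n f) ⟩
  f 0 + Σ< n (f ∘ suc) + f (suc n)         ≡⟨ +-assoc (f 0) (Σ< n (f ∘ suc)) (f (suc n)) ⟩
  f 0 + (Σ< n (f ∘ suc) + f (suc n))       ∎

Σ<-trailing-zero : ∀ n (f : ℕ → ℚ) → f n ≡ 0ℚ → Σ< (suc n) f ≡ Σ< n f
Σ<-trailing-zero n f fn≡0 = trans (cong (Σ< n f +_) fn≡0) (+-identityʳ (Σ< n f))

ℕ→ℚ-pascal : ∀ n k → ℕ→ℚ (suc n C suc k) ≡ ℕ→ℚ (n C k) + ℕ→ℚ (n C suc k)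
ℕ→ℚ-pascal n k = trans (cong ℕ→ℚ (sym (nCk+nC[k+1]≡[n+1]C[k+1] n k))) (ℕ→ℚ-+ (n C k) (n C suc k))

ℕ→ℚ-nC[1+n]≡0 : ∀ n → ℕ→ℚ (n C suc n) ≡ 0ℚ
ℕ→ℚ-nC[1+n]≡0 n = cong ℕ→ℚ (k>n⇒nCk≡0 (ℕ.n<1+n n))

alternatingSum : ℕ → (ℕ → ℚ) → ℚ
alternatingSum n a = Σ< n (λ k → sgn k * a k)

binomialTransform : (ℕ → ℚ) → ℕ → ℚ
binomialTransform a j = Σ< (suc j) (λ i → ℕ→ℚ (j C i) * a i)

alternatingBinomialSum : ℕ → (ℕ → ℚ) → ℚ
alternatingBinomialSum n f = Σ< n (λ j → sgn j * ℕ→ℚ (n C suc j) * f j)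

alternatingSum-suc : ∀ n a → alternatingSum (suc n) a ≡ a 0 - alternatingSum n (a ∘ suc)
alternatingSum-suc n a = begin
  alternatingSum (suc n) a                         ≡⟨ Σ<-suc n (λ k → sgn k * a k) ⟩
  1ℚ * a 0 + Σ< n (λ k → - sgn k * a (suc k))       ≡⟨ cong₂ _+_ (*-identityˡ (a 0))
                                                        (Σ<-cong n (λ k → sym (neg-distribˡ-* (sgn k) (a (suc k))))) ⟩
  a 0 + Σ< n (λ k → - (sgn k * a (suc k)))         ≡⟨ cong (a 0 +_) (Σ<-neg n (λ k → sgn k * a (suc k))) ⟩
  a 0 - alternatingSum n (a ∘ suc)                 ∎

binomialTransform-zero : ∀ a → binomialTransform a 0 ≡ a 0
binomialTransform-zero a = trans (+-identityˡ (1ℚ * a 0)) (*-identityˡ (a 0))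

binomialTransform-suc : ∀ a j →
  binomialTransform a (suc j) ≡ binomialTransform a j + binomialTransform (a ∘ suc) j
binomialTransform-suc a j = begin
  binomialTransform a (suc j)
    ≡⟨ Σ<-suc (suc j) (λ i → ℕ→ℚ (suc j C i) * a i) ⟩
  a₀ + Σ< (suc j) (λ i → ℕ→ℚ (suc j C suc i) * a (suc i))
    ≡⟨ cong (a₀ +_) (Σ<-cong (suc j) λ i →
         trans (cong (_* a (suc i)) (ℕ→ℚ-pascal j i)) (*-distribʳ-+ (a (suc i)) (ℕ→ℚ (j C i)) (ℕ→ℚ (j C suc i)))) ⟩
  a₀ + Σ< (suc j) (λ i → ℕ→ℚ (j C i) * a (suc i) + ℕ→ℚ (j C suc i) * a (suc i))
    ≡⟨ cong (a₀ +_) (Σ<-distrib-+ (suc j) _ _) ⟩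
  a₀ + (binomialTransform (a ∘ suc) j + Σ< (suc j) shifted)
    ≡⟨ cong (λ x → a₀ + (binomialTransform (a ∘ suc) j + x)) (Σ<-trailing-zero j shifted shifted-j≡0) ⟩
  a₀ + (binomialTransform (a ∘ suc) j + Σ< j shifted)
    ≡⟨ solve 3 (λ x y z → x :+ (y :+ z) := x :+ z :+ y) refl a₀ (binomialTransform (a ∘ suc) j) (Σ< j shifted) ⟩
  a₀ + Σ< j shifted + binomialTransform (a ∘ suc) j
    ≡⟨ cong (_+ binomialTransform (a ∘ suc) j) (sym (Σ<-suc j (λ i → ℕ→ℚ (j C i) * a i))) ⟩
  binomialTransform a j + binomialTransform (a ∘ suc) j ∎
  where
  a₀ : ℚ
  a₀ = ℕ→ℚ 1 * a 0
  shifted : ℕ → ℚ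
  shifted i = ℕ→ℚ (j C suc i) * a (suc i)
  shifted-j≡0 : shifted j ≡ 0ℚ
  shifted-j≡0 = trans (cong (_* a (suc j)) (ℕ→ℚ-nC[1+n]≡0 j)) (*-zeroˡ (a (suc j)))

alternatingBinomialSum-cong : ∀ n {f g : ℕ → ℚ} → (∀ j → f j ≡ g j) →
  alternatingBinomialSum n f ≡ alternatingBinomialSum n g
alternatingBinomialSum-cong n f≗g = Σ<-cong n (λ j → cong (sgn j * ℕ→ℚ (n C suc j) *_) (f≗g j))

alternatingBinomialSum-distrib-+ : ∀ n (f g : ℕ → ℚ) →
  alternatingBinomialSum n (λ j → f j + g j) ≡ alternatingBinomialSum n f + alternatingBinomialSum n g
alternatingBinomialSum-distrib-+ n f g =
  trans (Σ<-cong n (λ j → *-distribˡ-+ (sgn j * ℕ→ℚ (n C suc j)) (f j) (g j))) (Σ<-distrib-+ n _ _)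

alternatingBinomialSum-suc : ∀ n f →
  alternatingBinomialSum (suc n) f
    ≡ f 0 + alternatingBinomialSum n f - alternatingBinomialSum n (f ∘ suc)
alternatingBinomialSum-suc n f = begin
  alternatingBinomialSum (suc n) f
    ≡⟨ Σ<-cong (suc n) (λ j → trans (cong (λ c → sgn j * c * f j) (ℕ→ℚ-pascal n j))
         (solve 4 (λ s c d x → s :* (c :+ d) :* x := s :* c :* x :+ s :* d :* x)
           refl (sgn j) (ℕ→ℚ (n C j)) (ℕ→ℚ (n C suc j)) (f j))) ⟩
  Σ< (suc n) (λ j → sgn j * ℕ→ℚ (n C j) * f j + sgn j * ℕ→ℚ (n C suc j) * f j)
    ≡⟨ Σ<-distrib-+ (suc n) _ _ ⟩
  Σ< (suc n) (λ j → sgn j * ℕ→ℚ (n C j) * f j) + Σ< (suc n) upper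
    ≡⟨ cong₂ _+_ lower-sum (Σ<-trailing-zero n upper upper-n≡0) ⟩
  f 0 - alternatingBinomialSum n (f ∘ suc) + alternatingBinomialSum n f
    ≡⟨ solve 3 (λ x y z → x :- y :+ z := x :+ z :- y)
         refl (f 0) (alternatingBinomialSum n (f ∘ suc)) (alternatingBinomialSum n f) ⟩
  f 0 + alternatingBinomialSum n f - alternatingBinomialSum n (f ∘ suc) ∎
  where
  upper : ℕ → ℚ
  upper j = sgn j * ℕ→ℚ (n C suc j) * f j
  upper-n≡0 : upper n ≡ 0ℚ
  upper-n≡0 = trans (cong (λ c → sgn n * c * f n) (ℕ→ℚ-nC[1+n]≡0 n))
    (solve 2 (λ s x → s :* con 0ℚ :* x := con 0ℚ) refl (sgn n) (f n))
  lower-sum : Σ< (suc n) (λ j → sgn j * ℕ→ℚ (n C j) * f j) ≡ f 0 - alternatingBinomialSum n (f ∘ suc)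
  lower-sum = begin
    Σ< (suc n) (λ j → sgn j * ℕ→ℚ (n C j) * f j)
      ≡⟨ Σ<-suc n (λ j → sgn j * ℕ→ℚ (n C j) * f j) ⟩
    sgn 0 * ℕ→ℚ (n C 0) * f 0 + Σ< n (λ j → - sgn j * ℕ→ℚ (n C suc j) * f (suc j))
      ≡⟨ cong₂ _+_ (*-identityˡ (f 0)) (Σ<-cong n λ j →
           solve 3 (λ s c x → :- s :* c :* x := :- (s :* c :* x)) refl (sgn j) (ℕ→ℚ (n C suc j)) (f (suc j))) ⟩
    f 0 + Σ< n (λ j → - (sgn j * ℕ→ℚ (n C suc j) * f (suc j)))
      ≡⟨ cong (f 0 +_) (Σ<-neg n (λ j → sgn j * ℕ→ℚ (n C suc j) * f (suc j))) ⟩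
    f 0 - alternatingBinomialSum n (f ∘ suc) ∎

alternatingBinomialSum-binomialTransform : ∀ n a →
  alternatingBinomialSum n (binomialTransform a) ≡ alternatingSum n a
alternatingBinomialSum-binomialTransform zero    a = refl
alternatingBinomialSum-binomialTransform (suc n) a = begin
  alternatingBinomialSum (suc n) (binomialTransform a)
    ≡⟨ alternatingBinomialSum-suc n (binomialTransform a) ⟩
  binomialTransform a 0 + E (binomialTransform a) - E (binomialTransform a ∘ suc)
    ≡⟨ cong₂ (λ x y → x + E (binomialTransform a) - y) (binomialTransform-zero a)
         (trans (alternatingBinomialSum-cong n (binomialTransform-suc a))
                (alternatingBinomialSum-distrib-+ n (binomialTransform a) (binomialTransform (a ∘ suc)))) ⟩
  a 0 + E (binomialTransform a) - (E (binomialTransform a) + E (binomialTransform (a ∘ suc)))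
    ≡⟨ cong₂ (λ x y → a 0 + x - (x + y))
         (alternatingBinomialSum-binomialTransform n a) (alternatingBinomialSum-binomialTransform n (a ∘ suc)) ⟩
  a 0 + alternatingSum n a - (alternatingSum n a + alternatingSum n (a ∘ suc))
    ≡⟨ solve 3 (λ x y z → x :+ y :- (y :+ z) := x :- z) refl (a 0) (alternatingSum n a) (alternatingSum n (a ∘ suc)) ⟩
  a 0 - alternatingSum n (a ∘ suc)
    ≡⟨ alternatingSum-suc n a ⟨
  alternatingSum (suc n) a ∎
  where
  E : (ℕ → ℚ) → ℚ
  E = alternatingBinomialSum n

fallingFactorial : ℚ → ℕ → ℚ
fallingFactorial x zero    = 1ℚ
fallingFactorial x (suc i) = fallingFactorial x i * (x - ℕ→ℚ i)

fallingFactorial-0 : ∀ i → fallingFactorial 0ℚ (suc i) ≡ 0ℚ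
fallingFactorial-0 zero    = refl
fallingFactorial-0 (suc i) = trans (cong (_* (0ℚ - ℕ→ℚ (suc i))) (fallingFactorial-0 i)) (*-zeroˡ (0ℚ - ℕ→ℚ (suc i)))

fallingFactorial-1+ : ∀ x i → fallingFactorial (1ℚ + x) (suc i) ≡ (1ℚ + x) * fallingFactorial x i
fallingFactorial-1+ x zero    = solve 1 (λ x → con 1ℚ :* (con 1ℚ :+ x :- con 0ℚ) := (con 1ℚ :+ x) :* con 1ℚ) refl x
fallingFactorial-1+ x (suc i) = begin
  fallingFactorial (1ℚ + x) (suc i) * (1ℚ + x - ℕ→ℚ (suc i))
    ≡⟨ cong₂ (λ F k → F * (1ℚ + x - k)) (fallingFactorial-1+ x i) (ℕ→ℚ-suc i) ⟩
  (1ℚ + x) * fallingFactorial x i * (1ℚ + x - (1ℚ + ℕ→ℚ i))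
    ≡⟨ solve 3 (λ x F k → (con 1ℚ :+ x) :* F :* (con 1ℚ :+ x :- (con 1ℚ :+ k)) := (con 1ℚ :+ x) :* (F :* (x :- k)))
         refl x (fallingFactorial x i) (ℕ→ℚ i) ⟩
  (1ℚ + x) * (fallingFactorial x i * (x - ℕ→ℚ i)) ∎

C*!≡fallingFactorial : ∀ j i → ℕ→ℚ (j C i) * ℕ→ℚ (i !) ≡ fallingFactorial (ℕ→ℚ j) i
C*!≡fallingFactorial j       zero    = refl
C*!≡fallingFactorial zero    (suc i) = trans (*-zeroˡ (ℕ→ℚ (suc i !))) (sym (fallingFactorial-0 i))
C*!≡fallingFactorial (suc j) (suc i) = begin
  ℕ→ℚ (suc j C suc i) * ℕ→ℚ (suc i !)
    ≡⟨ cong (_* ℕ→ℚ (suc i !)) (ℕ→ℚ-pascal j i) ⟩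
  (c + c′) * ℕ→ℚ (suc i !)
    ≡⟨ *-distribʳ-+ (ℕ→ℚ (suc i !)) c c′ ⟩
  c * ℕ→ℚ (suc i !) + c′ * ℕ→ℚ (suc i !)
    ≡⟨ cong₂ (λ f F′ → c * f + F′) (ℕ→ℚ-* (suc i) (i !)) (C*!≡fallingFactorial j (suc i)) ⟩
  c * (ℕ→ℚ (suc i) * ℕ→ℚ (i !)) + F * (ℕ→ℚ j - ℕ→ℚ i)
    ≡⟨ cong (_+ F * (ℕ→ℚ j - ℕ→ℚ i))
         (trans (solve 3 (λ c k f → c :* (k :* f) := k :* (c :* f)) refl c (ℕ→ℚ (suc i)) (ℕ→ℚ (i !)))
                (cong₂ _*_ (ℕ→ℚ-suc i) (C*!≡fallingFactorial j i))) ⟩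
  (1ℚ + ℕ→ℚ i) * F + F * (ℕ→ℚ j - ℕ→ℚ i)
    ≡⟨ solve 3 (λ k F x → (con 1ℚ :+ k) :* F :+ F :* (x :- k) := (con 1ℚ :+ x) :* F) refl (ℕ→ℚ i) F (ℕ→ℚ j) ⟩
  (1ℚ + ℕ→ℚ j) * F
    ≡⟨ fallingFactorial-1+ (ℕ→ℚ j) i ⟨
  fallingFactorial (1ℚ + ℕ→ℚ j) (suc i)
    ≡⟨ cong (λ x → fallingFactorial x (suc i)) (ℕ→ℚ-suc j) ⟨
  fallingFactorial (ℕ→ℚ (suc j)) (suc i) ∎
  where
  c c′ F : ℚ
  c  = ℕ→ℚ (j C i)
  c′ = ℕ→ℚ (j C suc i)
  F  = fallingFactorial (ℕ→ℚ j) i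

poch-neg : ∀ x i → poch (- x) i ≡ sgn i * fallingFactorial x i
poch-neg x zero    = refl
poch-neg x (suc i) = begin
  poch (- x) i * (- x + ℕ→ℚ i)                  ≡⟨ cong (_* (- x + ℕ→ℚ i)) (poch-neg x i) ⟩
  sgn i * fallingFactorial x i * (- x + ℕ→ℚ i)  ≡⟨ solve 4 (λ σ F x k → σ :* F :* (:- x :+ k) := :- σ :* (F :* (x :- k)))
                                                      refl (sgn i) (fallingFactorial x i) x (ℕ→ℚ i) ⟩
  - sgn i * (fallingFactorial x i * (x - ℕ→ℚ i)) ∎

poch-oneMinus : ∀ j i → poch (oneMinus (suc j)) i ≡ sgn i * (ℕ→ℚ (j C i) * ℕ→ℚ (i !))
poch-oneMinus j i = begin
  poch (oneMinus (suc j)) i           ≡⟨ cong (λ x → poch x i) 1-[1+j]≡-j ⟩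
  poch (- ℕ→ℚ j) i                    ≡⟨ poch-neg (ℕ→ℚ j) i ⟩
  sgn i * fallingFactorial (ℕ→ℚ j) i  ≡⟨ cong (sgn i *_) (C*!≡fallingFactorial j i) ⟨
  sgn i * (ℕ→ℚ (j C i) * ℕ→ℚ (i !))   ∎
  where
  1-[1+j]≡-j : oneMinus (suc j) ≡ - ℕ→ℚ j
  1-[1+j]≡-j = trans (cong (λ x → 1ℚ - x) (ℕ→ℚ-suc j))
    (solve 1 (λ x → con 1ℚ :- (con 1ℚ :+ x) := :- x) refl (ℕ→ℚ j))

poch-1+ : ∀ a i → poch (1ℚ + a) i * a ≡ poch a i * (a + ℕ→ℚ i)
poch-1+ a zero    = solve 1 (λ a → con 1ℚ :* a := con 1ℚ :* (a :+ con 0ℚ)) refl a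
poch-1+ a (suc i) = begin
  poch (1ℚ + a) i * (1ℚ + a + ℕ→ℚ i) * a
    ≡⟨ solve 3 (λ P a k → P :* (con 1ℚ :+ a :+ k) :* a := P :* a :* (con 1ℚ :+ a :+ k)) refl (poch (1ℚ + a) i) a (ℕ→ℚ i) ⟩
  poch (1ℚ + a) i * a * (1ℚ + a + ℕ→ℚ i)
    ≡⟨ cong (_* (1ℚ + a + ℕ→ℚ i)) (poch-1+ a i) ⟩
  poch a i * (a + ℕ→ℚ i) * (1ℚ + a + ℕ→ℚ i)
    ≡⟨ solve 3 (λ P a k → P :* (a :+ k) :* (con 1ℚ :+ a :+ k) := P :* (a :+ k) :* (a :+ (con 1ℚ :+ k)))
         refl (poch a i) a (ℕ→ℚ i) ⟩
  poch a i * (a + ℕ→ℚ i) * (a + (1ℚ + ℕ→ℚ i))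
    ≡⟨ cong (λ k → poch a i * (a + ℕ→ℚ i) * (a + k)) (ℕ→ℚ-suc i) ⟨
  poch a i * (a + ℕ→ℚ i) * (a + ℕ→ℚ (suc i)) ∎

odd : ℕ → ℚ
odd i = ℕ→ℚ (2 ℕ.* i ℕ.+ 1)

poch-threeHalves : ∀ i → poch threeHalves i ≡ poch half i * odd i
poch-threeHalves i = begin
  poch threeHalves i
    ≡⟨ solve 1 (λ P → P := P :* con half :* con (ℕ→ℚ 2)) refl (poch threeHalves i) ⟩
  poch (1ℚ + half) i * half * ℕ→ℚ 2
    ≡⟨ cong (_* ℕ→ℚ 2) (poch-1+ half i) ⟩
  poch half i * (half + ℕ→ℚ i) * ℕ→ℚ 2
    ≡⟨ solve 2 (λ P k → P :* (con half :+ k) :* con (ℕ→ℚ 2) := P :* (con (ℕ→ℚ 2) :* k :+ con 1ℚ))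
         refl (poch half i) (ℕ→ℚ i) ⟩
  poch half i * (ℕ→ℚ 2 * ℕ→ℚ i + 1ℚ)
    ≡⟨ cong (λ x → poch half i * (x + 1ℚ)) (ℕ→ℚ-* 2 i) ⟨
  poch half i * (ℕ→ℚ (2 ℕ.* i) + 1ℚ)
    ≡⟨ cong (poch half i *_) (ℕ→ℚ-+ (2 ℕ.* i) 1) ⟨
  poch half i * odd i ∎

odd-pos : ∀ i → Positive (odd i)
odd-pos i = ℕ→ℚ-pos (2 ℕ.* i ℕ.+ 1) {{ℕ.≢-nonZero (ℕ.m+1+n≢0 (2 ℕ.* i))}}

pow-pos : ∀ q .{{_ : Positive q}} n → Positive (pow q n)
pow-pos q zero    = _
pow-pos q (suc n) = pos*pos⇒pos (pow q n) {{pow-pos q n}} q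

poch-pos : ∀ a .{{_ : Positive a}} i → Positive (poch a i)
poch-pos a zero    = _
poch-pos a (suc i) = pos*pos⇒pos (poch a i) {{poch-pos a i}} (a + ℕ→ℚ i) {{pos+nonNeg⇒pos a (ℕ→ℚ i) {{normalize-nonNeg i 1}}}}

pow-distrib-* : ∀ p q n → pow (p * q) n ≡ pow p n * pow q n
pow-distrib-* p q zero    = refl
pow-distrib-* p q (suc n) = trans (cong (_* (p * q)) (pow-distrib-* p q n))
  (solve 4 (λ P Q p q → P :* Q :* (p :* q) := P :* p :* (Q :* q)) refl (pow p n) (pow q n) p q)

pow-[-1]≡sgn : ∀ i → pow (- 1ℚ) i ≡ sgn i
pow-[-1]≡sgn zero    = refl
pow-[-1]≡sgn (suc i) = trans (cong (_* - 1ℚ) (pow-[-1]≡sgn i)) (solve 1 (λ σ → σ :* :- con 1ℚ := :- σ) refl (sgn i))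

sgn*sgn≡1 : ∀ i → sgn i * sgn i ≡ 1ℚ
sgn*sgn≡1 zero    = refl
sgn*sgn≡1 (suc i) = trans (solve 1 (λ σ → :- σ :* :- σ := σ :* σ) refl (sgn i)) (sgn*sgn≡1 i)

prodL-replicate : ∀ n q → prodL (replicate n q) ≡ pow q n
prodL-replicate zero    q = refl
prodL-replicate (suc n) q = trans (cong (q *_) (prodL-replicate n q)) (*-comm q (pow q n))

prodL-∷ʳ : ∀ xs q → prodL (xs ∷ʳ q) ≡ prodL xs * q
prodL-∷ʳ []       q = trans (*-identityʳ q) (sym (*-identityˡ q))
prodL-∷ʳ (x ∷ xs) q = trans (cong (x *_) (prodL-∷ʳ xs q)) (sym (*-assoc x (prodL xs) q))

÷'≡*1/ : ∀ p q .{{_ : Positive q}} → p ÷' q ≡ p * (1/ q) {{pos⇒nonZero q}}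
÷'≡*1/ p q with q ≟ 0ℚ
... | yes refl = contradiction (positive⁻¹ 0ℚ) (<-irrefl refl)
... | no _     = refl

÷'≡*[1÷'] : ∀ p q → p ÷' q ≡ p * (1ℚ ÷' q)
÷'≡*[1÷'] p q with q ≟ 0ℚ
... | yes _ = sym (*-zeroʳ p)
... | no _  = cong (p *_) (sym (*-identityˡ _))

1÷'q*q≡1 : ∀ q .{{_ : Positive q}} → (1ℚ ÷' q) * q ≡ 1ℚ
1÷'q*q≡1 q = begin
  (1ℚ ÷' q) * q  ≡⟨ cong (_* q) (trans (÷'≡*1/ 1ℚ q) (*-identityˡ (1/ q))) ⟩
  1/ q * q       ≡⟨ *-inverseˡ q ⟩
  1ℚ             ∎
  where instance _ = pos⇒nonZero q

*≡⇒÷'≡ : ∀ p q r .{{_ : Positive q}} → r * q ≡ p → p ÷' q ≡ r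
*≡⇒÷'≡ p q r r*q≡p = begin
  p ÷' q         ≡⟨ ÷'≡*1/ p q ⟩
  p * 1/ q       ≡⟨ cong (_* 1/ q) r*q≡p ⟨
  r * q * 1/ q   ≡⟨ *-assoc r q (1/ q) ⟩
  r * (q * 1/ q) ≡⟨ cong (r *_) (*-inverseʳ q) ⟩
  r * 1ℚ         ≡⟨ *-identityʳ r ⟩
  r              ∎
  where instance _ = pos⇒nonZero q

hypTerm-halves : ∀ s j i →
  hypTerm (replicate s half ∷ʳ oneMinus (suc j)) (replicate s threeHalves) (- 1ℚ) i
    ≡ ℕ→ℚ (j C i) * (1ℚ ÷' pow (odd i) s)
hypTerm-halves s j i = begin
  (prodL (map pochᵢ (replicate s half ∷ʳ oneMinus (suc j))) ÷' (prodL (map pochᵢ (replicate s threeHalves)) * f))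
    * pow (- 1ℚ) i
    ≡⟨ cong₂ (λ N D → (N ÷' (D * f)) * pow (- 1ℚ) i) numerator denominator ⟩
  ((pow A s * (σ * (c * f))) ÷' (pow P s * f)) * pow (- 1ℚ) i
    ≡⟨ cong₂ _*_ (*≡⇒÷'≡ _ _ (σ * (c * u)) {{denominator-pos}} cancel) (pow-[-1]≡sgn i) ⟩
  σ * (c * u) * σ
    ≡⟨ solve 3 (λ σ c u → σ :* (c :* u) :* σ := σ :* σ :* (c :* u)) refl σ c u ⟩
  σ * σ * (c * u)
    ≡⟨ cong (_* (c * u)) (sgn*sgn≡1 i) ⟩
  1ℚ * (c * u)
    ≡⟨ *-identityˡ (c * u) ⟩
  c * u ∎
  where
  pochᵢ : ℚ → ℚ
  pochᵢ a = poch a i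
  A P c f σ u : ℚ
  A = poch half i
  P = poch threeHalves i
  c = ℕ→ℚ (j C i)
  f = ℕ→ℚ (i !)
  σ = sgn i
  u = 1ℚ ÷' pow (odd i) s

  numerator : prodL (map pochᵢ (replicate s half ∷ʳ oneMinus (suc j))) ≡ pow A s * (σ * (c * f))
  numerator = begin
    prodL (map pochᵢ (replicate s half ∷ʳ oneMinus (suc j)))
      ≡⟨ cong prodL (map-++ pochᵢ (replicate s half) (oneMinus (suc j) ∷ [])) ⟩
    prodL (map pochᵢ (replicate s half) ∷ʳ pochᵢ (oneMinus (suc j)))
      ≡⟨ prodL-∷ʳ (map pochᵢ (replicate s half)) (pochᵢ (oneMinus (suc j))) ⟩
    prodL (map pochᵢ (replicate s half)) * pochᵢ (oneMinus (suc j))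
      ≡⟨ cong₂ _*_ (trans (cong prodL (map-replicate pochᵢ s half)) (prodL-replicate s A)) (poch-oneMinus j i) ⟩
    pow A s * (σ * (c * f)) ∎

  denominator : prodL (map pochᵢ (replicate s threeHalves)) ≡ pow P s
  denominator = trans (cong prodL (map-replicate pochᵢ s threeHalves)) (prodL-replicate s P)

  denominator-pos : Positive (pow P s * f)
  denominator-pos = pos*pos⇒pos (pow P s) {{pow-pos P {{poch-pos threeHalves i}} s}}
                                f {{ℕ→ℚ-pos (i !) {{i ℕ.!≢0}}}}

  cancel : σ * (c * u) * (pow P s * f) ≡ pow A s * (σ * (c * f))
  cancel = begin
    σ * (c * u) * (pow P s * f)
      ≡⟨ cong (λ x → σ * (c * u) * (x * f)) (trans (cong (λ x → pow x s) (poch-threeHalves i)) (pow-distrib-* A (odd i) s)) ⟩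
    σ * (c * u) * (pow A s * pow (odd i) s * f)
      ≡⟨ solve 6 (λ σ c u Aˢ Oˢ f → σ :* (c :* u) :* (Aˢ :* Oˢ :* f) := u :* Oˢ :* (Aˢ :* (σ :* (c :* f))))
           refl σ c u (pow A s) (pow (odd i) s) f ⟩
    u * pow (odd i) s * (pow A s * (σ * (c * f)))
      ≡⟨ cong (_* (pow A s * (σ * (c * f)))) (1÷'q*q≡1 (pow (odd i) s) {{pow-pos (odd i) {{odd-pos i}} s}}) ⟩
    1ℚ * (pow A s * (σ * (c * f)))
      ≡⟨ *-identityˡ (pow A s * (σ * (c * f))) ⟩
    pow A s * (σ * (c * f)) ∎

hypPartial-halves : ∀ s j →
  hypPartial (suc j) (replicate s half ∷ʳ oneMinus (suc j)) (replicate s threeHalves) (- 1ℚ)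
    ≡ binomialTransform (λ i → 1ℚ ÷' pow (odd i) s) j
hypPartial-halves s j = Σ<-cong (suc j) (hypTerm-halves s j)

corollary3p4 : ∀ (n s : ℕ) → 1 Data.Nat.≤ n → 1 Data.Nat.≤ s →
    Σ< n (λ k → sgn k ÷' pow (ℕ→ℚ (2 Data.Nat.* k Data.Nat.+ 1)) s)
      ≡ Σ< n (λ j → sgn j * ℕ→ℚ (n C suc j)
          * hypPartial (suc j) (replicate s half ∷ʳ oneMinus (suc j)) (replicate s threeHalves) (- 1ℚ))
corollary3p4 n s _ _ = begin
  Σ< n (λ k → sgn k ÷' pow (odd k) s)             ≡⟨ Σ<-cong n (λ k → ÷'≡*[1÷'] (sgn k) (pow (odd k) s)) ⟩
  alternatingSum n a                               ≡⟨ alternatingBinomialSum-binomialTransform n a ⟨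
  alternatingBinomialSum n (binomialTransform a)   ≡⟨ alternatingBinomialSum-cong n (λ j → sym (hypPartial-halves s j)) ⟩
  alternatingBinomialSum n (λ j → hypPartial (suc j) (replicate s half ∷ʳ oneMinus (suc j)) (replicate s threeHalves) (- 1ℚ)) ∎
  where
  a : ℕ → ℚ
  a k = 1ℚ ÷' pow (odd k) s
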